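{- For every signature $\mathcal{F}$ and every $c\in\mathbb{N}$, $\to_{\mathrm{RAISE}_c(\mathcal{F})}\subseteq\ \ge^c_{\mathrm{mul}}$.
   Context: $\mathcal{F}_N$ has symbols $f_d$ ($f\in\mathcal{F}$, $d\in N$), $\mathrm{height}(f_d)=d$. $\mathrm{Raise}(\mathcal{F})$ is the TRS of all rules $f_d(x_1,\dots,x_n)\to f_{d+1}(x_1,\dots,x_n)$ ($f\in\mathcal{F}$ $n$-ary, $d\in\mathbb{N}$, distinct variables); $\mathrm{RAISE}_c(\mathcal{F})$ is its restriction to the signature $\mathcal{F}_{\{0,\dots,c\}}$. For finite multisets over $\mathbb{N}$: $M>_{\mathrm{mul}}N$ iff $N=(M\setminus X)\cup Y$ for some $X\ne\varnothing$, $Y$ such that each $m\in Y$ has some $n\in X$ with $n<m$; $M\ge_{\mathrm{mul}}N$ iff $M>_{\mathrm{mul}}N$ or $M=N$. $\mathrm{drop}(M,c)$ removes all occurrences of $c$; $M\ge^c_{\mathrm{mul}}N$ iff $\mathrm{drop}(M,c)\ge_{\mathrm{mul}}\mathrm{drop}(N,c)$. For terms, $s\ge^c_{\mathrm{mul}}t$ iff $\mathrm{MFun}(s)\ge^c_{\mathrm{mul}}\mathrm{MFun}(t)$, where $\mathrm{MFun}(t)$ is the multiset of heights of the function symbols occurring in $t$. -}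

module Defs where

open import Level using (Level; _⊔_) renaming (suc to lsuc)
open import Data.Nat using (ℕ; zero; suc; _<_)
open import Data.Fin using (Fin; toℕ; inject₁) renaming (suc to fsuc)
open import Data.Vec using (Vec; []; _∷_; lookup)
open import Data.List using (List; []; _∷_; _++_; filter)
open import Data.List.Membership.Propositional using (_∈_)
open import Data.List.Relation.Binary.Permutation.Propositional using (_↭_)
open import Data.Product using (Σ; ∃; ∃-syntax; _×_; _,_)
open import Relation.Nullary using (¬_)
open import Relation.Binary.PropositionalEquality using (_≡_; _≢_)
import Data.Nat as N

record Signature : Set₁ where
  field
    Sym   : Set
    arity : Sym → ℕ
open Signature public

data Term (F : Signature) : Set where
  var : ℕ → Term F
  app : (f : Sym F) → Vec (Term F) (arity F f) → Term F

Subst : Signature → Set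
Subst F = ℕ → Term F

mutual
  _[_] : ∀ {F} → Term F → Subst F → Term F
  var x [ σ ] = σ x
  app f ts [ σ ] = app f (ts [ σ ]*)

  _[_]* : ∀ {F n} → Vec (Term F) n → Subst F → Vec (Term F) n
  [] [ σ ]* = []
  (t ∷ ts) [ σ ]* = (t [ σ ]) ∷ (ts [ σ ]*)

record Rule (F : Signature) : Set where
  constructor _⇒_
  field
    lhs rhs : Term F

TRS : Signature → Set₁
TRS F = Rule F → Set

mutual
  data _⊢_⟶_ {F : Signature} (R : TRS F) : Term F → Term F → Set where
    root : ∀ {l r} (σ : Subst F) → R (l ⇒ r) → R ⊢ (l [ σ ]) ⟶ (r [ σ ])
    arg  : ∀ {f ss ts} → R ⊢ ss ⟶* ts → R ⊢ app f ss ⟶ app f ts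

  data _⊢_⟶*_ {F : Signature} (R : TRS F) : ∀ {n} → Vec (Term F) n → Vec (Term F) n → Set where
    here  : ∀ {n s t} {ss : Vec (Term F) n} → R ⊢ s ⟶ t → R ⊢ (s ∷ ss) ⟶* (t ∷ ss)
    there : ∀ {n s} {ss ts : Vec (Term F) n} → R ⊢ ss ⟶* ts → R ⊢ (s ∷ ss) ⟶* (s ∷ ts)

-- The labelled signature F_{0..c}: symbols f_d with d ∈ {0,…,c}

Labelled : Signature → ℕ → Signature
Labelled F c = record { Sym = Sym F × Fin (suc c) ; arity = λ { (f , _) → arity F f } }

height : ∀ {F c} → Sym (Labelled F c) → ℕ
height (_ , d) = toℕ d

varVec : ∀ {F n} → Vec ℕ n → Vec (Term F) n
varVec [] = []
varVec (x ∷ xs) = var x ∷ varVec xs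

Distinct : ∀ {n} → Vec ℕ n → Set
Distinct {n} xs = ∀ (i j : Fin n) → lookup xs i ≡ lookup xs j → i ≡ j

-- RAISE_c(F): all rules f_d(x1..xn) → f_{d+1}(x1..xn) over F_{0..c}
-- (so d+1 ≤ c, i.e. d : Fin c), with distinct variables x1..xn.
RAISE : (F : Signature) (c : ℕ) → TRS (Labelled F c)
RAISE F c ρ =
  ∃[ f ] ∃[ d ] ∃[ xs ] (Distinct {arity F f} xs ×
    (ρ ≡ (app (f , inject₁ {c} d) (varVec xs) ⇒ app (f , fsuc d) (varVec xs))))

-- Finite multisets over ℕ, represented by lists up to permutation (_↭_)

Multiset : Set
Multiset = List ℕ

_>mul_ : Multiset → Multiset → Set
M >mul N = ∃[ X ] ∃[ Y ] ∃[ Rest ]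
  ( X ≢ []
  × M ↭ (X ++ Rest)
  × N ↭ (Rest ++ Y)
  × (∀ {m} → m ∈ Y → ∃[ n ] (n ∈ X × n < m)) )

data _≥mul_ (M N : Multiset) : Set where
  gt : M >mul N → M ≥mul N
  eq : M ↭ N → M ≥mul N

drop : Multiset → ℕ → Multiset
drop M c = filter (λ m → ¬? (m N.≟ c)) M
  where open import Relation.Nullary using (¬?)

_≥mul[_]_ : Multiset → ℕ → Multiset → Set
M ≥mul[ c ] N = drop M c ≥mul drop N c

mutual
  MFun : ∀ {F c} → Term (Labelled F c) → Multiset
  MFun (var _) = []
  MFun {F} {c} (app f ts) = height {F} {c} f ∷ MFun* {F} {c} ts

  MFun* : ∀ {F c n} → Vec (Term (Labelled F c)) n → Multiset
  MFun* [] = []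
  MFun* {F} {c} (t ∷ ts) = MFun {F} {c} t ++ MFun* ts

_≥mulᵗ[_]_ : ∀ {F c} → Term (Labelled F c) → ℕ → Term (Labelled F c) → Set
s ≥mulᵗ[ c ] t = MFun s ≥mul[ c ] MFun t

module Submission where

-- A single RAISE_c step rewrites exactly one symbol occurrence
-- f_d into f_{d+1} with d < c and leaves every other symbol of the term
-- unchanged.  On the level of MFun this means: the target multiset arises
-- from the source multiset by raising one element a < c to a + 1.
--
-- Independently, it
-- shows that raising one element below c decreases the multiset after
-- dropping c: the dropped source contains a, and the dropped target is the
-- rest plus at most the single larger element a + 1 (which disappears when
-- a + 1 = c).

open import Defs
open import Data.Nat using (ℕ; suc; _<_; _≟_)
open import Data.Nat.Properties using (<-irrefl; n<1+n)
open import Data.Fin using (toℕ)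
open import Data.Fin.Properties using (toℕ-inject₁; toℕ<n)
open import Data.Vec using (Vec; _∷_)
open import Data.List using ([]; _∷_; _++_)
open import Data.List.Properties using (filter-accept; filter-reject)
open import Data.List.Membership.Propositional using (_∈_)
open import Data.List.Relation.Unary.Any using (here)
open import Data.List.Relation.Binary.Permutation.Propositional
  using (_↭_; ↭-refl; ↭-sym; ↭-trans; ↭-reflexive)
open import Data.List.Relation.Binary.Permutation.Propositional.Properties
  using (++⁺ˡ; ++⁺ʳ; shift; ++-comm; filter-↭)
open import Data.Product using (∃-syntax; _×_; _,_)
open import Relation.Nullary using (¬_; ¬?; yes; no)
open import Relation.Binary.PropositionalEquality using (_≡_; refl; cong)

>mul-resp-↭ : ∀ {M M′ N N′} → M ↭ M′ → N ↭ N′ → M >mul N → M′ >mul N′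
>mul-resp-↭ M↭M′ N↭N′ (X , Y , Rest , X≢[] , M↭ , N↭ , Y<X) =
  X , Y , Rest , X≢[] , ↭-trans (↭-sym M↭M′) M↭ , ↭-trans (↭-sym N↭N′) N↭ , Y<X

replace-by-larger : ∀ a L Y → (∀ {m} → m ∈ Y → a < m) → (a ∷ L) >mul (L ++ Y)
replace-by-larger a L Y a<Y =
  a ∷ [] , Y , L , (λ ()) , ↭-refl , ↭-refl , λ m∈Y → a , here refl , a<Y m∈Y

drop-∷ : ∀ x L c → ∃[ Y ] (drop (x ∷ L) c ≡ Y ++ drop L c × (∀ {m} → m ∈ Y → m ≡ x))
drop-∷ x L c with x ≟ c
... | yes x≡c = [] , filter-reject (λ m → ¬? (m ≟ c)) (λ x≢c → x≢c x≡c) , λ ()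
... | no  x≢c = x ∷ [] , filter-accept (λ m → ¬? (m ≟ c)) x≢c , λ { (here m≡x) → m≡x }

drop-↭ : ∀ {M N} c → M ↭ N → drop M c ↭ drop N c
drop-↭ c = filter-↭ (λ m → ¬? (m ≟ c))

data RaisedOnce (c : ℕ) (M N : Multiset) : Set where
  raised : ∀ {a L} → a < c → M ↭ a ∷ L → N ↭ suc a ∷ L → RaisedOnce c M N

raised-++ˡ : ∀ {c M N} K → RaisedOnce c M N → RaisedOnce c (K ++ M) (K ++ N)
raised-++ˡ K (raised {a} {L} a<c M↭ N↭) =
  raised a<c (↭-trans (++⁺ˡ K M↭) (shift a K L))
             (↭-trans (++⁺ˡ K N↭) (shift (suc a) K L))

raised-++ʳ : ∀ {c M N} K → RaisedOnce c M N → RaisedOnce c (M ++ K) (N ++ K)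
raised-++ʳ K (raised a<c M↭ N↭) = raised a<c (++⁺ʳ K M↭) (++⁺ʳ K N↭)

-- Raising one element below c decreases the multiset once c is dropped:
-- a survives the drop on the left, and on the right only a + 1 > a may be added.
raised⇒≥mul : ∀ {c M N} → RaisedOnce c M N → M ≥mul[ c ] N
raised⇒≥mul {c} {M} {N} (raised {a} {L} a<c M↭ N↭) with drop-∷ (suc a) L c
... | Y , dropN≡ , Y≡1+a =
  gt (>mul-resp-↭ (↭-sym dropM↭) (↭-sym dropN↭)
       (replace-by-larger a (drop L c) Y λ m∈Y → larger-than-a (Y≡1+a m∈Y)))
  where
  a≢c : ¬ a ≡ c
  a≢c refl = <-irrefl refl a<c

  larger-than-a : ∀ {m} → m ≡ suc a → a < m
  larger-than-a refl = n<1+n a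

  dropM↭ : drop M c ↭ a ∷ drop L c
  dropM↭ = ↭-trans (drop-↭ c M↭) (↭-reflexive (filter-accept (λ m → ¬? (m ≟ c)) a≢c))

  dropN↭ : drop N c ↭ drop L c ++ Y
  dropN↭ = ↭-trans (drop-↭ c N↭) (↭-trans (↭-reflexive dropN≡) (++-comm Y (drop L c)))

module _ (F : Signature) (c : ℕ) where

  mutual
    step-raises : ∀ {s t} → RAISE F c ⊢ s ⟶ t →
                  RaisedOnce c (MFun {F} {c} s) (MFun {F} {c} t)
    step-raises (root σ (f , d , xs , _ , refl)) =
      raised (toℕ<n d) (↭-reflexive (cong (_∷ MFun* {F} {c} (varVec xs [ σ ]*)) (toℕ-inject₁ d)))
             ↭-refl
    step-raises (arg {f = g} ss⟶ts) =
      raised-++ˡ (height {F} {c} g ∷ []) (steps-raise ss⟶ts)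

    steps-raise : ∀ {n} {ss ts : Vec (Term (Labelled F c)) n} → RAISE F c ⊢ ss ⟶* ts →
                  RaisedOnce c (MFun* {F} {c} ss) (MFun* {F} {c} ts)
    steps-raise {ts = _ ∷ us} (here s⟶t) = raised-++ʳ (MFun* {F} {c} us) (step-raises s⟶t)
    steps-raise {ss = s ∷ _} (there ss⟶ts) = raised-++ˡ (MFun {F} {c} s) (steps-raise ss⟶ts)

lemma5p11 : (F : Signature) (c : ℕ) (s t : Term (Labelled F c)) →
    RAISE F c ⊢ s ⟶ t → s ≥mulᵗ[ c ] t
lemma5p11 F c s t s⟶t = raised⇒≥mul (step-raises F c s⟶t)
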